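{- Let $g:\{0,1\}^m \rightarrow \{0,1\}$ be a Boolean function and $\delta \in (0,\frac{1}{2}]$. Let $\mu$ be a probability distribution on $\{0,1\}^m$ with $\mathrm{bias}^\mu(\{0,1\}^m) \leq \delta$. Let $\mathcal{C}\subseteq\{0,1\}^m$ be a subcube such that $\Pr_{\mu} [ \mathcal{C}]>0$ and $\mathrm{bias}^\mu(\mathcal{C}) \leq \delta$. Then for any $b \in \{0,1\}$: (a) $\Pr_{\mu} [\mathcal{C}] \leq (1+4\delta)\cdot\Pr_{\mu_b} [\mathcal{C}]$; (b) $\Pr_{\mu} [\mathcal{C}] \geq (1-4\delta)\cdot\Pr_{\mu_b} [ \mathcal{C}]$.
   Context: A subcube of $\{0,1\}^m$ is a set $\{x: x_i=A(i)\ \forall i\in S\}$ for some $S\subseteq\{1,\ldots,m\}$ and $A:S\to\{0,1\}$. $\Pr_\mu[\mathcal{C}]$ denotes $\Pr_{x\sim\mu}[x\in\mathcal{C}]$. For a subcube $\mathcal{C}$ with $\Pr_\mu[\mathcal{C}]>0$, $\mathrm{bias}^\mu(\mathcal{C}) = |\Pr_{x\sim\mu}[g(x)=0\mid x\in\mathcal{C}]-\Pr_{x\sim\mu}[g(x)=1\mid x\in\mathcal{C}]|$. For $b\in\{0,1\}$, $\mu_b$ is $\mu$ conditioned on $g^{ -1}(b)$: $\mu_b(x)=0$ if $g(x)\neq b$ and $\mu_b(x)=\mu(x)/\sum_{y:g(y)=b}\mu(y)$ otherwise.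
   Formalization: The probability distribution μ takes rational values on {0,1}^m, and the parameter δ is rational. -}

module Defs where

open import Data.Bool using (Bool; true; false; if_then_else_; _∧_)
open import Data.Bool.Properties using () renaming (_≟_ to _≟ᵇ_)
open import Data.Nat using (ℕ; zero; suc)
open import Data.Vec using (Vec; []; _∷_)
open import Data.List using (List; []; _∷_; map; _++_; foldr; filter)
open import Data.Maybe using (Maybe; just; nothing)
open import Data.Rational using (ℚ; 0ℚ; 1ℚ; _+_; _-_; _*_; 1/_; ∣_∣; ≢-nonZero)
open import Data.Rational.Properties using (_≟_)
open import Relation.Nullary using (yes; no; does)

Point : ℕ → Set
Point m = Vec Bool m

allPoints : (m : ℕ) → List (Point m)
allPoints zero = [] ∷ []
allPoints (suc m) = map (false ∷_) (allPoints m) ++ map (true ∷_) (allPoints m)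

sumℚ : ∀ {A : Set} → (A → ℚ) → List A → ℚ
sumℚ f = foldr (λ a s → f a + s) 0ℚ

-- A subcube {x : x_i = A(i) ∀ i ∈ S} is encoded by a vector c with
-- c_i = just (A i) if i ∈ S and c_i = nothing if i ∉ S.
Subcube : ℕ → Set
Subcube m = Vec (Maybe Bool) m

inCube : ∀ {m} → Subcube m → Point m → Bool
inCube [] [] = true
inCube (nothing ∷ c) (_ ∷ x) = inCube c x
inCube (just a ∷ c) (xi ∷ x) = does (a ≟ᵇ xi) ∧ inCube c x

Dist : ℕ → Set
Dist m = Point m → ℚ

IsProbDist : ∀ {m} → Dist m → Set
IsProbDist {m} μ = (∀ x → Data.Rational._≤_ 0ℚ (μ x)) × (sumℚ μ (allPoints m) ≡ 1ℚ)
  where open import Data.Product using (_×_)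
        open import Relation.Binary.PropositionalEquality using (_≡_)

-- Total division: p / q, and 0 when q = 0 (only used where q > 0 is assumed)
_÷'_ : ℚ → ℚ → ℚ
p ÷' q with q ≟ 0ℚ
... | yes _ = 0ℚ
... | no q≢0 = p * (1/_ q {{≢-nonZero q≢0}})

PrCube : ∀ {m} → Dist m → Subcube m → ℚ
PrCube {m} μ C = sumℚ (λ x → if inCube C x then μ x else 0ℚ) (allPoints m)

PrValCube : ∀ {m} → Dist m → (Point m → Bool) → Bool → Subcube m → ℚ
PrValCube {m} μ g b C =
  sumℚ (λ x → if inCube C x ∧ does (g x ≟ᵇ b) then μ x else 0ℚ) (allPoints m)

-- bias^μ(C) = | Pr[g=0 | C] - Pr[g=1 | C] |   (meaningful when Pr_μ[C] > 0)
bias : ∀ {m} → Dist m → (Point m → Bool) → Subcube m → ℚ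
bias μ g C = ∣ (PrValCube μ g false C ÷' PrCube μ C) - (PrValCube μ g true C ÷' PrCube μ C) ∣

fullCube : (m : ℕ) → Subcube m
fullCube zero = []
fullCube (suc m) = nothing ∷ fullCube m

condDist : ∀ {m} → Dist m → (Point m → Bool) → Bool → Dist m
condDist {m} μ g b x =
  if does (g x ≟ᵇ b) then μ x ÷' sumℚ (λ y → if does (g y ≟ᵇ b) then μ y else 0ℚ) (allPoints m)
  else 0ℚ

{-# OPTIONS --safe #-}
module Submission where

open import Defs
open import Data.Bool using (Bool; true; false; not; if_then_else_; _∧_)
open import Data.Bool.Properties using () renaming (_≟_ to _≟ᵇ_)
open import Data.Nat using (ℕ)
open import Data.Vec using ([]; _∷_)
open import Data.List using (List; []; _∷_)
open import Data.Integer using (+_)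
open import Data.Rational
  using (ℚ; 0ℚ; 1ℚ; ½; _+_; _-_; _*_; _/_; _≤_; _<_; -_; 1/_; ∣_∣; ≢-nonZero; positive; nonNegative)
open import Data.Rational.Properties
open import Data.Rational.Solver using (module +-*-Solver)
open import Data.Product using (_×_; _,_)
open import Data.Sum using (inj₁; inj₂)
open import Relation.Nullary using (yes; no; does; contradiction)
open import Relation.Nullary.Decidable using (from-yes)
open import Relation.Binary.PropositionalEquality
open +-*-Solver using (solve; _:=_; _:+_; _:-_; _:*_; :-_; con)

-- Write x, y for the μ-masses of C ∩ g⁻¹(b) and C ∩ g⁻¹(¬b), and p, p' for those of
-- g⁻¹(b) and g⁻¹(¬b).  Each bias hypothesis says that a pair is δ-balanced:
-- |x - y| ≤ δ (x + y), resp. |p - p'| ≤ δ (p + p') where p + p' = 1.  Since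
-- Pr_{μ_b}[C] = x / p and p ≥ (1 - δ) / 2 > 0, the claims reduce to the homogeneous
--   (1 - 4δ) x (p + p') ≤ (x + y) p ≤ (1 + 4δ) x (p + p'),
-- whose gaps are explicit nonnegative combinations of the slacks δ (x + y) ± (x - y),
-- δ (p + p') ± (p - p') and ½ - δ.

p≤q⇒0≤q-p : ∀ {p q} → p ≤ q → 0ℚ ≤ q - p
p≤q⇒0≤q-p {p} {q} p≤q = subst (_≤ q - p) (+-inverseʳ p) (+-monoˡ-≤ (- p) p≤q)

p<q⇒0<q-p : ∀ {p q} → p < q → 0ℚ < q - p
p<q⇒0<q-p {p} {q} p<q = subst (_< q - p) (+-inverseʳ p) (+-monoˡ-< (- p) p<q)

0≤q-p⇒p≤q : ∀ {p q} → 0ℚ ≤ q - p → p ≤ q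
0≤q-p⇒p≤q {p} {q} 0≤q-p = subst₂ _≤_ (+-identityˡ p) (q-p+p≡q p q) (+-monoˡ-≤ p 0≤q-p)
  where
  q-p+p≡q : ∀ p q → q - p + p ≡ q
  q-p+p≡q = solve 2 (λ p q → q :- p :+ p := q) refl

+-nonNeg : ∀ {p q} → 0ℚ ≤ p → 0ℚ ≤ q → 0ℚ ≤ p + q
+-nonNeg 0≤p 0≤q = +-mono-≤ 0≤p 0≤q

*-nonNeg : ∀ {p q} → 0ℚ ≤ p → 0ℚ ≤ q → 0ℚ ≤ p * q
*-nonNeg {p} {q} 0≤p 0≤q =
  nonNegative⁻¹ (p * q) {{nonNeg*nonNeg⇒nonNeg p {{nonNegative 0≤p}} q {{nonNegative 0≤q}}}}

*-pos : ∀ {p q} → 0ℚ < p → 0ℚ < q → 0ℚ < p * q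
*-pos {p} {q} 0<p 0<q = positive⁻¹ (p * q) {{pos*pos⇒pos p {{positive 0<p}} q {{positive 0<q}}}}

p≤∣p∣ : ∀ p → p ≤ ∣ p ∣
p≤∣p∣ p with ≤-total 0ℚ p
... | inj₁ 0≤p = ≤-reflexive (sym (0≤p⇒∣p∣≡p 0≤p))
... | inj₂ p≤0 = ≤-trans p≤0 (0≤∣p∣ p)

∣p∣≤q⇒0≤q-p : ∀ {p q} → ∣ p ∣ ≤ q → 0ℚ ≤ q - p
∣p∣≤q⇒0≤q-p {p} ∣p∣≤q = p≤q⇒0≤q-p (≤-trans (p≤∣p∣ p) ∣p∣≤q)

∣p∣≤q⇒0≤q+p : ∀ {p q} → ∣ p ∣ ≤ q → 0ℚ ≤ q + p
∣p∣≤q⇒0≤q+p {p} {q} ∣p∣≤q =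
  subst (0ℚ ≤_) (q-[-p]≡q+p q p) (∣p∣≤q⇒0≤q-p (subst (_≤ q) (sym (∣-p∣≡∣p∣ p)) ∣p∣≤q))
  where
  q-[-p]≡q+p : ∀ q p → q - (- p) ≡ q + p
  q-[-p]≡q+p = solve 2 (λ q p → q :- (:- p) := q :+ p) refl

∣p-q∣≡∣q-p∣ : ∀ p q → ∣ p - q ∣ ≡ ∣ q - p ∣
∣p-q∣≡∣q-p∣ p q = trans (cong ∣_∣ (p-q≡-[q-p] p q)) (∣-p∣≡∣p∣ (q - p))
  where
  p-q≡-[q-p] : ∀ p q → p - q ≡ - (q - p)
  p-q≡-[q-p] = solve 2 (λ p q → p :- q := :- (q :- p)) refl

½<1 : ½ < 1ℚ
½<1 = from-yes (½ <? 1ℚ)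

Balanced : ℚ → ℚ → ℚ → Set
Balanced δ x y = ∣ x - y ∣ ≤ δ * (x + y)

Balanced-sym : ∀ {δ x y} → Balanced δ x y → Balanced δ y x
Balanced-sym {δ} {x} {y} = subst₂ _≤_ (∣p-q∣≡∣q-p∣ x y) (cong (δ *_) (+-comm x y))

Balanced⇒pos : ∀ {δ x y} → δ < 1ℚ → 0ℚ < x + y → Balanced δ x y → 0ℚ < x
Balanced⇒pos {δ} {x} {y} δ<1 0<x+y balanced =
  subst (0ℚ <_) (sym (x≡ x y δ)) (+-mono-≤-< slack (*-pos (positive⁻¹ ½) (*-pos (p<q⇒0<q-p δ<1) 0<x+y)))
  where
  x≡ : ∀ x y δ → x ≡ ½ * (δ * (x + y) + (x - y)) + ½ * ((1ℚ - δ) * (x + y))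
  x≡ = solve 3 (λ x y δ → x := con ½ :* (δ :* (x :+ y) :+ (x :- y)) :+ con ½ :* ((con 1ℚ :- δ) :* (x :+ y))) refl
  slack : 0ℚ ≤ ½ * (δ * (x + y) + (x - y))
  slack = *-nonNeg (nonNegative⁻¹ ½) (∣p∣≤q⇒0≤q+p balanced)

module _ {δ x y p p' : ℚ} (0≤δ : 0ℚ ≤ δ) (δ≤½ : δ ≤ ½) (0≤x+y : 0ℚ ≤ x + y) (0≤p+p' : 0ℚ ≤ p + p')
         (x≈y : Balanced δ x y) (p≈p' : Balanced δ p p') where

  private
    0≤½ : 0ℚ ≤ ½
    0≤½ = nonNegative⁻¹ ½

    0≤1+4δ : 0ℚ ≤ 1ℚ + (+ 4 / 1) * δ
    0≤1+4δ = +-nonNeg (nonNegative⁻¹ 1ℚ) (*-nonNeg (nonNegative⁻¹ (+ 4 / 1)) 0≤δ)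

    0≤2δ : 0ℚ ≤ (+ 2 / 1) * δ
    0≤2δ = *-nonNeg (nonNegative⁻¹ (+ 2 / 1)) 0≤δ

    0≤½-δ : 0ℚ ≤ ½ - δ
    0≤½-δ = p≤q⇒0≤q-p δ≤½

  balanced-upper : (x + y) * p ≤ (1ℚ + (+ 4 / 1) * δ) * x * (p + p')
  balanced-upper = 0≤q-p⇒p≤q (subst (0ℚ ≤_) (sym (gap δ x y p p')) (
      +-nonNeg (+-nonNeg
        (*-nonNeg (*-nonNeg (*-nonNeg 0≤½ 0≤1+4δ) 0≤p+p') (∣p∣≤q⇒0≤q+p x≈y))
        (*-nonNeg (*-nonNeg 0≤½ 0≤x+y) (∣p∣≤q⇒0≤q-p p≈p')))
        (*-nonNeg (*-nonNeg (*-nonNeg 0≤2δ 0≤x+y) 0≤p+p') 0≤½-δ)))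
    where
    gap : ∀ δ x y p p' → (1ℚ + (+ 4 / 1) * δ) * x * (p + p') - (x + y) * p
        ≡ ½ * (1ℚ + (+ 4 / 1) * δ) * (p + p') * (δ * (x + y) + (x - y))
          + ½ * (x + y) * (δ * (p + p') - (p - p'))
          + (+ 2 / 1) * δ * (x + y) * (p + p') * (½ - δ)
    gap = solve 5 (λ δ x y p p' →
        (con 1ℚ :+ con (+ 4 / 1) :* δ) :* x :* (p :+ p') :- (x :+ y) :* p
      := con ½ :* (con 1ℚ :+ con (+ 4 / 1) :* δ) :* (p :+ p') :* (δ :* (x :+ y) :+ (x :- y))
         :+ con ½ :* (x :+ y) :* (δ :* (p :+ p') :- (p :- p'))
         :+ con (+ 2 / 1) :* δ :* (x :+ y) :* (p :+ p') :* (con ½ :- δ)) refl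

  -- The certificate covers both signs of 1 - 4δ, so no case split is needed.
  balanced-lower : (1ℚ - (+ 4 / 1) * δ) * x * (p + p') ≤ (x + y) * p
  balanced-lower = 0≤q-p⇒p≤q (subst (0ℚ ≤_) (sym (gap δ x y p p')) (
      +-nonNeg (+-nonNeg (+-nonNeg
        (*-nonNeg (*-nonNeg 0≤½ 0≤x+y) (∣p∣≤q⇒0≤q+p p≈p'))
        (*-nonNeg (*-nonNeg 0≤½ 0≤p+p') (∣p∣≤q⇒0≤q-p x≈y)))
        (*-nonNeg (*-nonNeg 0≤2δ 0≤p+p') (∣p∣≤q⇒0≤q+p x≈y)))
        (*-nonNeg (*-nonNeg (*-nonNeg 0≤2δ 0≤x+y) 0≤p+p') 0≤½-δ)))
    where
    gap : ∀ δ x y p p' → (x + y) * p - (1ℚ - (+ 4 / 1) * δ) * x * (p + p')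
        ≡ ½ * (x + y) * (δ * (p + p') + (p - p'))
          + ½ * (p + p') * (δ * (x + y) - (x - y))
          + (+ 2 / 1) * δ * (p + p') * (δ * (x + y) + (x - y))
          + (+ 2 / 1) * δ * (x + y) * (p + p') * (½ - δ)
    gap = solve 5 (λ δ x y p p' →
        (x :+ y) :* p :- (con 1ℚ :- con (+ 4 / 1) :* δ) :* x :* (p :+ p')
      := con ½ :* (x :+ y) :* (δ :* (p :+ p') :+ (p :- p'))
         :+ con ½ :* (p :+ p') :* (δ :* (x :+ y) :- (x :- y))
         :+ con (+ 2 / 1) :* δ :* (p :+ p') :* (δ :* (x :+ y) :+ (x :- y))
         :+ con (+ 2 / 1) :* δ :* (x :+ y) :* (p :+ p') :* (con ½ :- δ)) refl

÷'≡*1÷' : ∀ p q → p ÷' q ≡ p * (1ℚ ÷' q)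
÷'≡*1÷' p q with q ≟ 0ℚ
... | yes _ = sym (*-zeroʳ p)
... | no _  = cong (p *_) (sym (*-identityˡ _))

÷'-*-cancelʳ : ∀ p {q} → q ≢ 0ℚ → (p ÷' q) * q ≡ p
÷'-*-cancelʳ p {q} q≢0 with q ≟ 0ℚ
... | yes q≡0 = contradiction q≡0 q≢0
... | no q≢0′ = begin
  p * 1/q * q    ≡⟨ *-assoc p 1/q q ⟩
  p * (1/q * q)  ≡⟨ cong (p *_) (*-inverseˡ q {{≢-nonZero q≢0′}}) ⟩
  p * 1ℚ         ≡⟨ *-identityʳ p ⟩
  p              ∎
  where
  open ≡-Reasoning
  1/q = (1/ q) {{≢-nonZero q≢0′}}

*-÷'-assoc : ∀ r p q → r * (p ÷' q) ≡ (r * p) ÷' q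
*-÷'-assoc r p q = begin
  r * (p ÷' q)          ≡⟨ cong (r *_) (÷'≡*1÷' p q) ⟩
  r * (p * (1ℚ ÷' q))   ≡⟨ *-assoc r p (1ℚ ÷' q) ⟨
  r * p * (1ℚ ÷' q)     ≡⟨ ÷'≡*1÷' (r * p) q ⟨
  (r * p) ÷' q          ∎
  where open ≡-Reasoning

÷'-distribʳ-sub : ∀ p r q → p ÷' q - r ÷' q ≡ (p - r) ÷' q
÷'-distribʳ-sub p r q = begin
  p ÷' q - r ÷' q                 ≡⟨ cong₂ _-_ (÷'≡*1÷' p q) (÷'≡*1÷' r q) ⟩
  p * (1ℚ ÷' q) - r * (1ℚ ÷' q)   ≡⟨ *-distribʳ-sub p r (1ℚ ÷' q) ⟩
  (p - r) * (1ℚ ÷' q)             ≡⟨ ÷'≡*1÷' (p - r) q ⟨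
  (p - r) ÷' q                    ∎
  where
  open ≡-Reasoning
  *-distribʳ-sub : ∀ p r i → p * i - r * i ≡ (p - r) * i
  *-distribʳ-sub = solve 3 (λ p r i → p :* i :- r :* i := (p :- r) :* i) refl

*≤⇒≤÷' : ∀ {p q r} → 0ℚ < q → p * q ≤ r → p ≤ r ÷' q
*≤⇒≤÷' {p} {q} {r} 0<q p*q≤r =
  *-cancelʳ-≤-pos q {{positive 0<q}} (subst (p * q ≤_) (sym (÷'-*-cancelʳ r (≢-sym (<⇒≢ 0<q)))) p*q≤r)

≤*⇒÷'≤ : ∀ {p q r} → 0ℚ < q → r ≤ p * q → r ÷' q ≤ p
≤*⇒÷'≤ {p} {q} {r} 0<q r≤p*q =
  *-cancelʳ-≤-pos q {{positive 0<q}} (subst (_≤ p * q) (sym (÷'-*-cancelʳ r (≢-sym (<⇒≢ 0<q)))) r≤p*q)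

∣÷'∣≤⇒∣∣≤* : ∀ {p q δ} → 0ℚ < q → ∣ p ÷' q ∣ ≤ δ → ∣ p ∣ ≤ δ * q
∣÷'∣≤⇒∣∣≤* {p} {q} {δ} 0<q ∣p÷'q∣≤δ = begin
  ∣ p ∣                  ≡⟨ cong ∣_∣ (÷'-*-cancelʳ p (≢-sym (<⇒≢ 0<q))) ⟨
  ∣ (p ÷' q) * q ∣       ≡⟨ ∣p*q∣≡∣p∣*∣q∣ (p ÷' q) q ⟩
  ∣ p ÷' q ∣ * ∣ q ∣     ≡⟨ cong (∣ p ÷' q ∣ *_) (0≤p⇒∣p∣≡p (<⇒≤ 0<q)) ⟩
  ∣ p ÷' q ∣ * q         ≤⟨ *-monoʳ-≤-nonNeg q {{nonNegative (<⇒≤ 0<q)}} ∣p÷'q∣≤δ ⟩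
  δ * q                  ∎
  where open ≤-Reasoning

balanced-ratio-bounds : ∀ {δ x y p p'} → 0ℚ ≤ δ → δ ≤ ½ → 0ℚ ≤ x + y →
  Balanced δ x y → Balanced δ p p' → p + p' ≡ 1ℚ →
  (x + y ≤ (1ℚ + (+ 4 / 1) * δ) * (x ÷' p)) × ((1ℚ - (+ 4 / 1) * δ) * (x ÷' p) ≤ x + y)
balanced-ratio-bounds {δ} {x} {y} {p} {p'} 0≤δ δ≤½ 0≤x+y x≈y p≈p' p+p'≡1 =
  subst (x + y ≤_) (sym (*-÷'-assoc (1ℚ + (+ 4 / 1) * δ) x p)) (*≤⇒≤÷' 0<p upper) ,
  subst (_≤ x + y) (sym (*-÷'-assoc (1ℚ - (+ 4 / 1) * δ) x p)) (≤*⇒÷'≤ 0<p lower)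
  where
  0<p+p' : 0ℚ < p + p'
  0<p+p' = subst (0ℚ <_) (sym p+p'≡1) (positive⁻¹ 1ℚ)
  0<p : 0ℚ < p
  0<p = Balanced⇒pos (≤-<-trans δ≤½ ½<1) 0<p+p' p≈p'
  *total : ∀ v → v * (p + p') ≡ v
  *total v = trans (cong (v *_) p+p'≡1) (*-identityʳ v)
  upper : (x + y) * p ≤ (1ℚ + (+ 4 / 1) * δ) * x
  upper = subst ((x + y) * p ≤_) (*total _)
    (balanced-upper {δ} {x} {y} {p} {p'} 0≤δ δ≤½ 0≤x+y (<⇒≤ 0<p+p') x≈y p≈p')
  lower : (1ℚ - (+ 4 / 1) * δ) * x ≤ (x + y) * p
  lower = subst (_≤ (x + y) * p) (*total _)
    (balanced-lower {δ} {x} {y} {p} {p'} 0≤δ δ≤½ 0≤x+y (<⇒≤ 0<p+p') x≈y p≈p')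

sumℚ-cong : ∀ {A : Set} {f g : A → ℚ} (l : List A) → (∀ a → f a ≡ g a) → sumℚ f l ≡ sumℚ g l
sumℚ-cong []      f≗g = refl
sumℚ-cong (a ∷ l) f≗g = cong₂ _+_ (f≗g a) (sumℚ-cong l f≗g)

sumℚ-+ : ∀ {A : Set} (f g : A → ℚ) (l : List A) → sumℚ (λ a → f a + g a) l ≡ sumℚ f l + sumℚ g l
sumℚ-+ f g []      = sym (+-identityʳ 0ℚ)
sumℚ-+ f g (a ∷ l) = trans (cong (_+_ (f a + g a)) (sumℚ-+ f g l)) (+-interchange (f a) (g a) (sumℚ f l) (sumℚ g l))
  where
  +-interchange : ∀ a b c d → (a + b) + (c + d) ≡ (a + c) + (b + d)
  +-interchange = solve 4 (λ a b c d → (a :+ b) :+ (c :+ d) := (a :+ c) :+ (b :+ d)) refl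

sumℚ-*ʳ : ∀ {A : Set} (f : A → ℚ) (c : ℚ) (l : List A) → sumℚ (λ a → f a * c) l ≡ sumℚ f l * c
sumℚ-*ʳ f c []      = sym (*-zeroˡ c)
sumℚ-*ʳ f c (a ∷ l) = trans (cong (_+_ (f a * c)) (sumℚ-*ʳ f c l)) (sym (*-distribʳ-+ c (f a) (sumℚ f l)))

sumℚ-÷' : ∀ {A : Set} (f : A → ℚ) (q : ℚ) (l : List A) → sumℚ (λ a → f a ÷' q) l ≡ sumℚ f l ÷' q
sumℚ-÷' f q l = begin
  sumℚ (λ a → f a ÷' q) l          ≡⟨ sumℚ-cong l (λ a → ÷'≡*1÷' (f a) q) ⟩
  sumℚ (λ a → f a * (1ℚ ÷' q)) l   ≡⟨ sumℚ-*ʳ f (1ℚ ÷' q) l ⟩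
  sumℚ f l * (1ℚ ÷' q)             ≡⟨ ÷'≡*1÷' (sumℚ f l) q ⟨
  sumℚ f l ÷' q                    ∎
  where open ≡-Reasoning

inCube-fullCube : ∀ {m} (x : Point m) → inCube (fullCube m) x ≡ true
inCube-fullCube []      = refl
inCube-fullCube (_ ∷ x) = inCube-fullCube x

PrCube-fullCube : ∀ {m} {μ : Dist m} → IsProbDist μ → PrCube μ (fullCube m) ≡ 1ℚ
PrCube-fullCube {m} {μ} (_ , μ-total) =
  trans (sumℚ-cong (allPoints m) (λ x → cong (if_then μ x else 0ℚ) (inCube-fullCube x))) μ-total

module _ {m : ℕ} (μ : Dist m) (g : Point m → Bool) where

  PrCube-split : ∀ b C → PrCube μ C ≡ PrValCube μ g b C + PrValCube μ g (not b) C
  PrCube-split b C =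
    trans (sumℚ-cong (allPoints m) (λ x → if-split (inCube C x) (g x) b (μ x)))
          (sumℚ-+ (onValue b) (onValue (not b)) (allPoints m))
    where
    onValue : Bool → Point m → ℚ
    onValue b x = if inCube C x ∧ does (g x ≟ᵇ b) then μ x else 0ℚ
    if-split : ∀ c v b u → (if c then u else 0ℚ)
             ≡ (if c ∧ does (v ≟ᵇ b) then u else 0ℚ) + (if c ∧ does (v ≟ᵇ not b) then u else 0ℚ)
    if-split false _     _     _ = sym (+-identityʳ 0ℚ)
    if-split true  false false u = sym (+-identityʳ u)
    if-split true  false true  u = sym (+-identityˡ u)
    if-split true  true  false u = sym (+-identityˡ u)
    if-split true  true  true  u = sym (+-identityʳ u)

  PrCube-condDist : ∀ b C → PrCube (condDist μ g b) C ≡ PrValCube μ g b C ÷' PrValCube μ g b (fullCube m)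
  PrCube-condDist b C = begin
    PrCube (condDist μ g b) C
      ≡⟨ sumℚ-cong (allPoints m) (λ x → if-÷' (inCube C x) (does (g x ≟ᵇ b)) (μ x)) ⟩
    sumℚ (λ x → (if inCube C x ∧ does (g x ≟ᵇ b) then μ x else 0ℚ) ÷' Pr[g≡b]) (allPoints m)
      ≡⟨ sumℚ-÷' _ Pr[g≡b] (allPoints m) ⟩
    PrValCube μ g b C ÷' Pr[g≡b]
      ≡⟨ cong (PrValCube μ g b C ÷'_) (sumℚ-cong (allPoints m) onFullCube) ⟨
    PrValCube μ g b C ÷' PrValCube μ g b (fullCube m)
      ∎
    where
    open ≡-Reasoning
    Pr[g≡b] : ℚ
    Pr[g≡b] = sumℚ (λ y → if does (g y ≟ᵇ b) then μ y else 0ℚ) (allPoints m)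
    0÷'≡0 : 0ℚ ≡ 0ℚ ÷' Pr[g≡b]
    0÷'≡0 = sym (trans (÷'≡*1÷' 0ℚ Pr[g≡b]) (*-zeroˡ (1ℚ ÷' Pr[g≡b])))
    if-÷' : ∀ c d u → (if c then (if d then u ÷' Pr[g≡b] else 0ℚ) else 0ℚ)
          ≡ (if c ∧ d then u else 0ℚ) ÷' Pr[g≡b]
    if-÷' true  true  u = refl
    if-÷' true  false u = 0÷'≡0
    if-÷' false _     u = 0÷'≡0
    onFullCube : ∀ x → (if inCube (fullCube m) x ∧ does (g x ≟ᵇ b) then μ x else 0ℚ)
                     ≡ (if does (g x ≟ᵇ b) then μ x else 0ℚ)
    onFullCube x = cong (λ c → if c ∧ does (g x ≟ᵇ b) then μ x else 0ℚ) (inCube-fullCube x)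

  bias≤⇒Balanced : ∀ {δ} C → 0ℚ < PrCube μ C → bias μ g C ≤ δ →
    ∀ b → Balanced δ (PrValCube μ g b C) (PrValCube μ g (not b) C)
  bias≤⇒Balanced {δ} C 0<PrC bias≤δ false =
    subst (λ P → ∣ V false - V true ∣ ≤ δ * P) (PrCube-split false C)
      (∣÷'∣≤⇒∣∣≤* 0<PrC (subst (λ d → ∣ d ∣ ≤ δ) (÷'-distribʳ-sub (V false) (V true) (PrCube μ C)) bias≤δ))
    where
    V : Bool → ℚ
    V b = PrValCube μ g b C
  bias≤⇒Balanced {δ} C 0<PrC bias≤δ true =
    Balanced-sym {δ} {PrValCube μ g false C} (bias≤⇒Balanced C 0<PrC bias≤δ false)

claim2 : (m : ℕ) (g : Point m → Bool) (δ : ℚ) → 0ℚ < δ → δ ≤ ½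
    → (μ : Dist m) → IsProbDist μ → bias μ g (fullCube m) ≤ δ
    → (C : Subcube m) → 0ℚ < PrCube μ C → bias μ g C ≤ δ
    → (b : Bool)
    → (PrCube μ C ≤ (1ℚ + (+ 4 / 1) * δ) * PrCube (condDist μ g b) C)
      × ((1ℚ - (+ 4 / 1) * δ) * PrCube (condDist μ g b) C ≤ PrCube μ C)
claim2 m g δ 0<δ δ≤½ μ μ-prob biasFull≤δ C 0<PrC biasC≤δ b =
  subst₂ (λ P r → (P ≤ (1ℚ + (+ 4 / 1) * δ) * r) × ((1ℚ - (+ 4 / 1) * δ) * r ≤ P))
    (sym (PrCube-split μ g b C)) (sym (PrCube-condDist μ g b C))
    (balanced-ratio-bounds {δ} {x} {y} {p} {p'} (<⇒≤ 0<δ) δ≤½ 0≤x+y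
      (bias≤⇒Balanced μ g C 0<PrC biasC≤δ b)
      (bias≤⇒Balanced μ g (fullCube m) 0<PrFull biasFull≤δ b)
      (trans (sym (PrCube-split μ g b (fullCube m))) (PrCube-fullCube μ-prob)))
  where
  x y p p' : ℚ
  x  = PrValCube μ g b C
  y  = PrValCube μ g (not b) C
  p  = PrValCube μ g b (fullCube m)
  p' = PrValCube μ g (not b) (fullCube m)
  0≤x+y : 0ℚ ≤ x + y
  0≤x+y = subst (0ℚ ≤_) (PrCube-split μ g b C) (<⇒≤ 0<PrC)
  0<PrFull : 0ℚ < PrCube μ (fullCube m)
  0<PrFull = subst (0ℚ <_) (sym (PrCube-fullCube μ-prob)) (positive⁻¹ 1ℚ)
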